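{- In $\mathbb{Z}[x,y]$, the polynomials $C_1(3)=x^3+x^2+x+y^2+y+1$, $C_2(3)=y^3+y^2+y+x^2+x+1$, $C_3(3)=xy-1$ form a (D-)Gröbner basis for the ideal generated by $H_1=y^4+y^3+y^2+y+1+x$, $H_2=y^4+xy^4+xy^3+xy^2+xy+x$, $H_3=y+x^4+x^3+x^2+x+1$, $H_4=x^4y+x^3y+x^2y+xy+y+x^4$ (the polynomials of the tiles of $\mathcal{T}_6$).
   Context: Terms in $\mathbb{Z}[x,y]$ are ordered by degree-lexicographic order with $x>y$: $1<y<x<y^2<xy<x^2<y^3<\cdots$. For $P\neq0$, $HM(P)$ is its leading monomial. $f$ D-reduces to $g$ modulo $p$ if some monomial $m$ of $f$ equals $m'\cdot HM(p)$ for a monomial $m'$ with integer coefficient, and $g=f-m'p$; a D-normal form modulo a finite set $G$ is obtained by repeated such reductions until none applies. A finite set $G$ is a D-Gröbner basis if all D-normal forms modulo $G$ of elements of the ideal $I(G)$ are $0$; it is a Gröbner basis of an ideal $I$ if moreover $I(G)=I$. -}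

module Defs where

open import Data.Nat using (ℕ; zero; suc; _≟_) renaming (_+_ to _+ℕ_; _<_ to _<ℕ_)
open import Data.Integer using (ℤ; +_; -_) renaming (_+_ to _+ℤ_; _*_ to _*ℤ_)
open import Data.Product using (Σ; _×_; _,_; ∃)
open import Data.List using (List; []; _∷_; _++_; map; concatMap; foldr)
open import Data.List.Relation.Unary.All using (All)
open import Data.List.Membership.Propositional using (_∈_)
open import Data.Sum using (_⊎_)
open import Relation.Nullary using (¬_; yes; no)
open import Relation.Binary.PropositionalEquality using (_≡_)
open import Relation.Binary.Construct.Closure.ReflexiveTransitive using (Star)
open import Function.Bundles using (_⇔_)

-- Polynomials in ℤ[x,y], represented as finite lists of terms
-- (c , i , j) meaning c·x^i·y^j.  Lists need not be normalised; the
-- polynomial denoted is determined by its coefficient function, and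
-- polynomial equality is equality of coefficient functions.

Term : Set
Term = ℤ × ℕ × ℕ

Poly : Set
Poly = List Term

coeff : Poly → ℕ → ℕ → ℤ
coeff [] i j = + 0
coeff ((c , a , b) ∷ p) i j with a ≟ i | b ≟ j
... | yes _ | yes _ = c +ℤ coeff p i j
... | _     | _     = coeff p i j

_≈_ : Poly → Poly → Set
p ≈ q = ∀ i j → coeff p i j ≡ coeff q i j

infix 4 _≈_

IsZero : Poly → Set
IsZero p = ∀ i j → coeff p i j ≡ + 0

_⊕_ : Poly → Poly → Poly
p ⊕ q = p ++ q

⊖_ : Poly → Poly
⊖ p = map (λ { (c , a , b) → (- c , a , b) }) p

_⊝_ : Poly → Poly → Poly
p ⊝ q = p ⊕ (⊖ q)

mulTerm : Term → Term → Term
mulTerm (c , a , b) (d , a' , b') = (c *ℤ d , a +ℕ a' , b +ℕ b')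

_⊗_ : Poly → Poly → Poly
p ⊗ q = concatMap (λ t → map (mulTerm t) q) p

infixl 6 _⊕_ _⊝_
infixl 7 _⊗_

sumP : List Poly → Poly
sumP = foldr _⊕_ []

_<dl_ : ℕ × ℕ → ℕ × ℕ → Set
(i , j) <dl (i' , j') = (i +ℕ j <ℕ i' +ℕ j') ⊎ ((i +ℕ j ≡ i' +ℕ j') × (i <ℕ i'))

IsHead : Poly → ℕ → ℕ → ℤ → Set
IsHead p i j lc =
  (coeff p i j ≡ lc) × (¬ (lc ≡ + 0)) ×
  (∀ i' j' → (i , j) <dl (i' , j') → coeff p i' j' ≡ + 0)

DReduces : Poly → Poly → Poly → Set
DReduces p f g =
  Σ ℕ λ i → Σ ℕ λ j →
  Σ ℕ λ a → Σ ℕ λ b → Σ ℤ λ d →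
  Σ ℕ λ i₀ → Σ ℕ λ j₀ → Σ ℤ λ lc →
    (¬ (coeff f i j ≡ + 0)) ×
    IsHead p i₀ j₀ lc ×
    (i ≡ a +ℕ i₀) × (j ≡ b +ℕ j₀) ×
    (coeff f i j ≡ d *ℤ lc) ×
    (g ≈ f ⊝ ((d , a , b) ∷ []) ⊗ p)

DReducesG : List Poly → Poly → Poly → Set
DReducesG G f g = Σ Poly λ p → (p ∈ G) × DReduces p f g

DNormalForm : List Poly → Poly → Poly → Set
DNormalForm G f g = Star (DReducesG G) f g × (∀ h → ¬ DReducesG G g h)

InIdeal : List Poly → Poly → Set
InIdeal G f =
  Σ (List (Poly × Poly)) λ qs →
    All (λ { (q , g) → g ∈ G }) qs ×
    (f ≈ sumP (map (λ { (q , g) → q ⊗ g }) qs))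

IsDGroebnerBasis : List Poly → Set
IsDGroebnerBasis G = ∀ f g → InIdeal G f → DNormalForm G f g → IsZero g

IsGroebnerBasisOf : List Poly → List Poly → Set
IsGroebnerBasisOf G H = IsDGroebnerBasis G × (∀ f → InIdeal G f ⇔ InIdeal H f)

C₁ C₂ C₃ H₁ H₂ H₃ H₄ : Poly
C₁ = (+ 1 , 3 , 0) ∷ (+ 1 , 2 , 0) ∷ (+ 1 , 1 , 0) ∷ (+ 1 , 0 , 2) ∷ (+ 1 , 0 , 1) ∷ (+ 1 , 0 , 0) ∷ []
C₂ = (+ 1 , 0 , 3) ∷ (+ 1 , 0 , 2) ∷ (+ 1 , 0 , 1) ∷ (+ 1 , 2 , 0) ∷ (+ 1 , 1 , 0) ∷ (+ 1 , 0 , 0) ∷ []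
C₃ = (+ 1 , 1 , 1) ∷ (- (+ 1) , 0 , 0) ∷ []
H₁ = (+ 1 , 0 , 4) ∷ (+ 1 , 0 , 3) ∷ (+ 1 , 0 , 2) ∷ (+ 1 , 0 , 1) ∷ (+ 1 , 0 , 0) ∷ (+ 1 , 1 , 0) ∷ []
H₂ = (+ 1 , 0 , 4) ∷ (+ 1 , 1 , 4) ∷ (+ 1 , 1 , 3) ∷ (+ 1 , 1 , 2) ∷ (+ 1 , 1 , 1) ∷ (+ 1 , 1 , 0) ∷ []
H₃ = (+ 1 , 0 , 1) ∷ (+ 1 , 4 , 0) ∷ (+ 1 , 3 , 0) ∷ (+ 1 , 2 , 0) ∷ (+ 1 , 1 , 0) ∷ (+ 1 , 0 , 0) ∷ []
H₄ = (+ 1 , 4 , 1) ∷ (+ 1 , 3 , 1) ∷ (+ 1 , 2 , 1) ∷ (+ 1 , 1 , 1) ∷ (+ 1 , 0 , 1) ∷ (+ 1 , 4 , 0) ∷ []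

module Submission where

-- The quotient ℤ[x,y]/(C₁, C₂, C₃) is built by hand as ℤ⁵ with basis 1, x, x², y, y²:
-- multiplication by x and by y are commuting linear maps (reduce x³ by C₁, y³ by C₂ and
-- xy by C₃), and evaluating a polynomial at them on the vector of 1 gives a linear map
-- eval with eval (q ⊗ g) = 0 whenever eval g = 0.  As eval kills C₁, C₂, C₃, it kills
-- their ideal and is unchanged along D-reductions modulo them.  A D-normal form has no
-- monomial divisible by a head term x³, y³ or xy, so it is a combination of 1, x, x², y,
-- y², whose coefficients eval reads off; hence a D-normal form of an ideal element is 0.
-- The two ideals coincide because each generator of one is an explicit combination of the
-- generators of the other.

open import Defs
open import Data.Nat using (ℕ; zero; suc; z≤n; s≤s; _∸_; _⊔_)
  renaming (_+_ to _+ℕ_; _<_ to _<ℕ_; _≤_ to _≤ℕ_; _≟_ to _≟ℕ_)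
import Data.Nat.Properties as ℕ
open import Data.Integer using (ℤ; +_; -_; -1ℤ; _-_) renaming (_+_ to _+ℤ_; _*_ to _*ℤ_)
import Data.Integer as ℤ
import Data.Integer.Properties as ℤ
open import Data.Integer.Tactic.RingSolver using (solve-∀)
open import Data.Product using (_×_; _,_; proj₁; proj₂)
open import Data.Product.Properties using (≡-dec)
open import Data.Sum using (_⊎_; inj₁; inj₂)
open import Data.Empty using (⊥-elim)
open import Data.List using (List; []; _∷_; _++_; map; foldr; filter; length)
import Data.List.Properties as List
open import Data.List.Relation.Unary.All using (All; []; _∷_; all?)
import Data.List.Relation.Unary.All as All
import Data.List.Relation.Unary.All.Properties as All
open import Data.List.Relation.Unary.Any using (here; there)
open import Data.List.Membership.Propositional using (_∈_)
import Data.List.Membership.DecPropositional as DecMembership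
open import Function using (_∘_; _$_)
open import Function.Bundles using (mk⇔)
import Function.Endo.Propositional as Endo
open import Relation.Nullary using (¬_; ¬?; yes; no; Dec)
open import Relation.Nullary.Decidable
  using (map′; _×-dec_; _⊎-dec_; decidable-stable; from-yes; True; toWitness)
open import Relation.Binary.Bundles using (Setoid)
open import Relation.Binary.PropositionalEquality
open import Relation.Binary.Construct.Closure.ReflexiveTransitive using (Star; ε; _◅_)
import Relation.Binary.Reasoning.Setoid as SetoidReasoning

monomial : Term → ℕ × ℕ
monomial (_ , a , b) = a , b

_≟ₘ_ : ∀ (m n : ℕ × ℕ) → Dec (m ≡ n)
_≟ₘ_ = ≡-dec ℕ._≟_ ℕ._≟_

coeff-∷-≡ : ∀ t p {i j} → monomial t ≡ (i , j) → coeff (t ∷ p) i j ≡ proj₁ t +ℤ coeff p i j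
coeff-∷-≡ (c , a , b) p {i} {j} refl with a ≟ℕ i | b ≟ℕ j
... | yes _  | yes _  = refl
... | yes _  | no b≢b = ⊥-elim (b≢b refl)
... | no a≢a | _      = ⊥-elim (a≢a refl)

coeff-∷-≢ : ∀ t p {i j} → monomial t ≢ (i , j) → coeff (t ∷ p) i j ≡ coeff p i j
coeff-∷-≢ (c , a , b) p {i} {j} t≢ij with a ≟ℕ i | b ≟ℕ j
... | yes refl | yes refl = ⊥-elim (t≢ij refl)
... | yes _    | no _     = refl
... | no _     | _        = refl

coeff-∷-cong : ∀ t {p q i j} → coeff p i j ≡ coeff q i j → coeff (t ∷ p) i j ≡ coeff (t ∷ q) i j
coeff-∷-cong t {p} {q} {i} {j} eq with monomial t ≟ₘ (i , j)
... | yes t≡ij = trans (coeff-∷-≡ t p t≡ij) (trans (cong (proj₁ t +ℤ_) eq) (sym (coeff-∷-≡ t q t≡ij)))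
... | no t≢ij  = trans (coeff-∷-≢ t p t≢ij) (trans eq (sym (coeff-∷-≢ t q t≢ij)))

coeff-∉ : ∀ p i j → All (λ t → monomial t ≢ (i , j)) p → coeff p i j ≡ + 0
coeff-∉ []      i j []             = refl
coeff-∉ (t ∷ p) i j (t≢ij ∷ p∌ij) = trans (coeff-∷-≢ t p t≢ij) (coeff-∉ p i j p∌ij)

IsZero-zeroCoefficients : ∀ p → All (λ t → proj₁ t ≡ + 0) p → IsZero p
IsZero-zeroCoefficients []      []            i j = refl
IsZero-zeroCoefficients (t ∷ p) (t≡0 ∷ p≡0) i j with monomial t ≟ₘ (i , j)
... | yes t≡ij = trans (coeff-∷-≡ t p t≡ij) (cong₂ _+ℤ_ t≡0 (IsZero-zeroCoefficients p p≡0 i j))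
... | no t≢ij  = trans (coeff-∷-≢ t p t≢ij) (IsZero-zeroCoefficients p p≡0 i j)

coeff-⊕ : ∀ p q i j → coeff (p ⊕ q) i j ≡ coeff p i j +ℤ coeff q i j
coeff-⊕ [] q i j = sym (ℤ.+-identityˡ _)
coeff-⊕ ((c , a , b) ∷ p) q i j with a ≟ℕ i | b ≟ℕ j
... | yes _ | yes _ = trans (cong (c +ℤ_) (coeff-⊕ p q i j)) (sym (ℤ.+-assoc c _ _))
... | yes _ | no _  = coeff-⊕ p q i j
... | no _  | _     = coeff-⊕ p q i j

coeff-⊖ : ∀ p i j → coeff (⊖ p) i j ≡ - coeff p i j
coeff-⊖ [] i j = refl
coeff-⊖ ((c , a , b) ∷ p) i j with a ≟ℕ i | b ≟ℕ j
... | yes _ | yes _ = trans (cong (- c +ℤ_) (coeff-⊖ p i j)) (sym (ℤ.neg-distrib-+ c _))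
... | yes _ | no _  = coeff-⊖ p i j
... | no _  | _     = coeff-⊖ p i j

≈-setoid : Setoid _ _
≈-setoid = record
  { Carrier       = Poly
  ; _≈_           = _≈_
  ; isEquivalence = record
    { refl  = λ _ _ → refl
    ; sym   = λ p≈q i j → sym (p≈q i j)
    ; trans = λ p≈q q≈r i j → trans (p≈q i j) (q≈r i j)
    }
  }

open Setoid ≈-setoid using () renaming (reflexive to ≡⇒≈)

⊕-cong : ∀ {p p′ q q′} → p ≈ p′ → q ≈ q′ → p ⊕ q ≈ p′ ⊕ q′
⊕-cong {p} {p′} {q} {q′} p≈p′ q≈q′ i j = begin
  coeff (p ⊕ q) i j             ≡⟨ coeff-⊕ p q i j ⟩
  coeff p i j +ℤ coeff q i j    ≡⟨ cong₂ _+ℤ_ (p≈p′ i j) (q≈q′ i j) ⟩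
  coeff p′ i j +ℤ coeff q′ i j  ≡⟨ coeff-⊕ p′ q′ i j ⟨
  coeff (p′ ⊕ q′) i j           ∎
  where open ≡-Reasoning

≈⇒IsZero-⊝ : ∀ {p q} → p ≈ q → IsZero (p ⊝ q)
≈⇒IsZero-⊝ {p} {q} p≈q i j = begin
  coeff (p ⊝ q) i j                 ≡⟨ coeff-⊕ p (⊖ q) i j ⟩
  coeff p i j +ℤ coeff (⊖ q) i j    ≡⟨ cong₂ _+ℤ_ (p≈q i j) (coeff-⊖ q i j) ⟩
  coeff q i j +ℤ - coeff q i j      ≡⟨ ℤ.+-inverseʳ (coeff q i j) ⟩
  + 0                               ∎
  where open ≡-Reasoning

monomial≢? : ∀ m t → Dec (monomial t ≢ m)
monomial≢? m t = ¬? (monomial t ≟ₘ m)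

deleteMonomial : ℕ × ℕ → Poly → Poly
deleteMonomial m = filter (monomial≢? m)

coeff-deleteMonomial-same : ∀ i j p → coeff (deleteMonomial (i , j) p) i j ≡ + 0
coeff-deleteMonomial-same i j p = coeff-∉ _ i j (All.all-filter (monomial≢? (i , j)) p)

coeff-deleteMonomial-other : ∀ m p {i j} → m ≢ (i , j) → coeff (deleteMonomial m p) i j ≡ coeff p i j
coeff-deleteMonomial-other m []      m≢ij = refl
coeff-deleteMonomial-other m (t ∷ p) {i} {j} m≢ij = byCase (monomial t ≟ₘ m)
  where
  open ≡-Reasoning
  byCase : Dec (monomial t ≡ m) → coeff (deleteMonomial m (t ∷ p)) i j ≡ coeff (t ∷ p) i j
  byCase (yes t≡m) = begin
    coeff (deleteMonomial m (t ∷ p)) i j ≡⟨ cong (λ r → coeff r i j) (List.filter-reject (monomial≢? m) (_$ t≡m)) ⟩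
    coeff (deleteMonomial m p) i j       ≡⟨ coeff-deleteMonomial-other m p m≢ij ⟩
    coeff p i j                          ≡⟨ coeff-∷-≢ t p (λ t≡ij → m≢ij (trans (sym t≡m) t≡ij)) ⟨
    coeff (t ∷ p) i j                    ∎
  byCase (no t≢m) = begin
    coeff (deleteMonomial m (t ∷ p)) i j ≡⟨ cong (λ r → coeff r i j) (List.filter-accept (monomial≢? m) t≢m) ⟩
    coeff (t ∷ deleteMonomial m p) i j   ≡⟨ coeff-∷-cong t (coeff-deleteMonomial-other m p m≢ij) ⟩
    coeff (t ∷ p) i j                    ∎

IsZero-deleteMonomial : ∀ m p → IsZero p → IsZero (deleteMonomial m p)
IsZero-deleteMonomial m p p≈0 i j with m ≟ₘ (i , j)
... | yes refl = coeff-deleteMonomial-same i j p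
... | no m≢ij  = trans (coeff-deleteMonomial-other m p m≢ij) (p≈0 i j)

length-deleteMonomial-head : ∀ t p → length (deleteMonomial (monomial t) (t ∷ p)) ≤ℕ length p
length-deleteMonomial-head t p =
  subst (λ r → length r ≤ℕ length p) (sym (List.filter-reject (monomial≢? (monomial t)) (_$ refl)))
        (List.length-filter (monomial≢? (monomial t)) p)

infixr 7 _*ₜ_

_*ₜ_ : Term → Poly → Poly
t *ₜ g = map (mulTerm t) g

coeff-*ₜ-shifted : ∀ c a b g i j → coeff ((c , a , b) *ₜ g) (a +ℕ i) (b +ℕ j) ≡ c *ℤ coeff g i j
coeff-*ₜ-shifted c a b []                    i j = sym (ℤ.*-zeroʳ c)
coeff-*ₜ-shifted c a b (s@(d , a′ , b′) ∷ g) i j with (a′ , b′) ≟ₘ (i , j)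
... | yes refl = begin
  coeff (mulTerm (c , a , b) s ∷ (c , a , b) *ₜ g) (a +ℕ a′) (b +ℕ b′)
    ≡⟨ coeff-∷-≡ (mulTerm (c , a , b) s) ((c , a , b) *ₜ g) refl ⟩
  c *ℤ d +ℤ coeff ((c , a , b) *ₜ g) (a +ℕ a′) (b +ℕ b′)
    ≡⟨ cong (c *ℤ d +ℤ_) (coeff-*ₜ-shifted c a b g a′ b′) ⟩
  c *ℤ d +ℤ c *ℤ coeff g a′ b′
    ≡⟨ ℤ.*-distribˡ-+ c d _ ⟨
  c *ℤ (d +ℤ coeff g a′ b′)
    ≡⟨ cong (c *ℤ_) (coeff-∷-≡ s g refl) ⟨
  c *ℤ coeff (s ∷ g) a′ b′
    ∎
  where open ≡-Reasoning
... | no s≢ij  = begin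
  coeff (mulTerm (c , a , b) s ∷ (c , a , b) *ₜ g) (a +ℕ i) (b +ℕ j) ≡⟨ coeff-∷-≢ _ _ shifted≢ ⟩
  coeff ((c , a , b) *ₜ g) (a +ℕ i) (b +ℕ j)                         ≡⟨ coeff-*ₜ-shifted c a b g i j ⟩
  c *ℤ coeff g i j                                                   ≡⟨ cong (c *ℤ_) (coeff-∷-≢ s g s≢ij) ⟨
  c *ℤ coeff (s ∷ g) i j                                             ∎
  where
  open ≡-Reasoning
  shifted≢ : (a +ℕ a′ , b +ℕ b′) ≢ (a +ℕ i , b +ℕ j)
  shifted≢ eq = s≢ij (cong₂ _,_ (ℕ.+-cancelˡ-≡ a a′ i (cong proj₁ eq)) (ℕ.+-cancelˡ-≡ b b′ j (cong proj₂ eq)))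

coeff-*ₜ-nonMultiple : ∀ c a b g i j → ¬ (a ≤ℕ i × b ≤ℕ j) → coeff ((c , a , b) *ₜ g) i j ≡ + 0
coeff-*ₜ-nonMultiple c a b g i j ij∉ = coeff-∉ _ i j (All.map⁺ (All.universal ≢ij g))
  where
  ≢ij : ∀ s → monomial (mulTerm (c , a , b) s) ≢ (i , j)
  ≢ij (_ , a′ , b′) refl = ij∉ (ℕ.m≤m+n a a′ , ℕ.m≤m+n b b′)

*ₜ-cong : ∀ t {g g′} → g ≈ g′ → t *ₜ g ≈ t *ₜ g′
*ₜ-cong (c , a , b) {g} {g′} g≈g′ i j with a ℕ.≤? i ×-dec b ℕ.≤? j
... | yes (a≤i , b≤j) = begin
  coeff ((c , a , b) *ₜ g) i j                            ≡⟨ shift g ⟨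
  coeff ((c , a , b) *ₜ g) (a +ℕ (i ∸ a)) (b +ℕ (j ∸ b))  ≡⟨ coeff-*ₜ-shifted c a b g _ _ ⟩
  c *ℤ coeff g (i ∸ a) (j ∸ b)                            ≡⟨ cong (c *ℤ_) (g≈g′ _ _) ⟩
  c *ℤ coeff g′ (i ∸ a) (j ∸ b)                           ≡⟨ coeff-*ₜ-shifted c a b g′ _ _ ⟨
  coeff ((c , a , b) *ₜ g′) (a +ℕ (i ∸ a)) (b +ℕ (j ∸ b)) ≡⟨ shift g′ ⟩
  coeff ((c , a , b) *ₜ g′) i j                           ∎
  where
  open ≡-Reasoning
  shift : ∀ h → coeff ((c , a , b) *ₜ h) (a +ℕ (i ∸ a)) (b +ℕ (j ∸ b)) ≡ coeff ((c , a , b) *ₜ h) i j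
  shift h = cong₂ (coeff ((c , a , b) *ₜ h)) (ℕ.m+[n∸m]≡n a≤i) (ℕ.m+[n∸m]≡n b≤j)
... | no ij∉ = trans (coeff-*ₜ-nonMultiple c a b g i j ij∉) (sym (coeff-*ₜ-nonMultiple c a b g′ i j ij∉))

⊗-congʳ : ∀ q {g g′} → g ≈ g′ → q ⊗ g ≈ q ⊗ g′
⊗-congʳ []      g≈g′ i j = refl
⊗-congʳ (t ∷ q) {g} {g′} g≈g′ =
  ⊕-cong {t *ₜ g} {t *ₜ g′} {q ⊗ g} {q ⊗ g′} (*ₜ-cong t {g} {g′} g≈g′) (⊗-congʳ q g≈g′)

⊗-distribˡ-⊕ : ∀ q g g′ → q ⊗ (g ⊕ g′) ≈ q ⊗ g ⊕ q ⊗ g′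
⊗-distribˡ-⊕ []      g g′ i j = refl
⊗-distribˡ-⊕ (t ∷ q) g g′ i j = begin
  coeff (t *ₜ (g ⊕ g′) ⊕ q ⊗ (g ⊕ g′)) i j
    ≡⟨ cong (λ s → coeff (s ⊕ q ⊗ (g ⊕ g′)) i j) (List.map-++ (mulTerm t) g g′) ⟩
  coeff ((t *ₜ g ⊕ t *ₜ g′) ⊕ q ⊗ (g ⊕ g′)) i j
    ≡⟨ coeff-⊕ (t *ₜ g ⊕ t *ₜ g′) _ i j ⟩
  coeff (t *ₜ g ⊕ t *ₜ g′) i j +ℤ coeff (q ⊗ (g ⊕ g′)) i j
    ≡⟨ cong₂ _+ℤ_ (coeff-⊕ (t *ₜ g) _ i j) (trans (⊗-distribˡ-⊕ q g g′ i j) (coeff-⊕ (q ⊗ g) _ i j)) ⟩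
  (coeff (t *ₜ g) i j +ℤ coeff (t *ₜ g′) i j) +ℤ (coeff (q ⊗ g) i j +ℤ coeff (q ⊗ g′) i j)
    ≡⟨ interchange (coeff (t *ₜ g) i j) (coeff (t *ₜ g′) i j) (coeff (q ⊗ g) i j) _ ⟩
  (coeff (t *ₜ g) i j +ℤ coeff (q ⊗ g) i j) +ℤ (coeff (t *ₜ g′) i j +ℤ coeff (q ⊗ g′) i j)
    ≡⟨ cong₂ _+ℤ_ (coeff-⊕ (t *ₜ g) _ i j) (coeff-⊕ (t *ₜ g′) _ i j) ⟨
  coeff (t *ₜ g ⊕ q ⊗ g) i j +ℤ coeff (t *ₜ g′ ⊕ q ⊗ g′) i j
    ≡⟨ coeff-⊕ (t *ₜ g ⊕ q ⊗ g) _ i j ⟨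
  coeff ((t *ₜ g ⊕ q ⊗ g) ⊕ (t *ₜ g′ ⊕ q ⊗ g′)) i j
    ∎
  where
  open ≡-Reasoning
  interchange : ∀ w x y z → (w +ℤ x) +ℤ (y +ℤ z) ≡ (w +ℤ y) +ℤ (x +ℤ z)
  interchange = solve-∀

⊗-distribʳ-⊕ : ∀ p p′ g → (p ⊕ p′) ⊗ g ≡ p ⊗ g ⊕ p′ ⊗ g
⊗-distribʳ-⊕ []      p′ g = refl
⊗-distribʳ-⊕ (t ∷ p) p′ g =
  trans (cong (t *ₜ g ⊕_) (⊗-distribʳ-⊕ p p′ g)) (sym (List.++-assoc (t *ₜ g) (p ⊗ g) (p′ ⊗ g)))

mulTerm-assoc : ∀ t s u → mulTerm t (mulTerm s u) ≡ mulTerm (mulTerm t s) u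
mulTerm-assoc (c , a , b) (d , a′ , b′) (e , a″ , b″) =
  cong₂ _,_ (sym (ℤ.*-assoc c d e)) (cong₂ _,_ (sym (ℕ.+-assoc a a′ a″)) (sym (ℕ.+-assoc b b′ b″)))

*ₜ-⊗ : ∀ t r g → t *ₜ (r ⊗ g) ≡ (t *ₜ r) ⊗ g
*ₜ-⊗ t []      g = refl
*ₜ-⊗ t (s ∷ r) g = begin
  t *ₜ (s *ₜ g ⊕ r ⊗ g)                         ≡⟨ List.map-++ (mulTerm t) (s *ₜ g) (r ⊗ g) ⟩
  t *ₜ (s *ₜ g) ⊕ t *ₜ (r ⊗ g)                  ≡⟨ cong₂ _⊕_ (sym (List.map-∘ g)) (*ₜ-⊗ t r g) ⟩
  map (mulTerm t ∘ mulTerm s) g ⊕ (t *ₜ r) ⊗ g  ≡⟨ cong (_⊕ (t *ₜ r) ⊗ g) (List.map-cong (mulTerm-assoc t s) g) ⟩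
  mulTerm t s *ₜ g ⊕ (t *ₜ r) ⊗ g               ∎
  where open ≡-Reasoning

⊗-assoc : ∀ q r g → q ⊗ (r ⊗ g) ≡ (q ⊗ r) ⊗ g
⊗-assoc []      r g = refl
⊗-assoc (t ∷ q) r g =
  trans (cong₂ _⊕_ (*ₜ-⊗ t r g) (⊗-assoc q r g)) (sym (⊗-distribʳ-⊕ (t *ₜ r) (q ⊗ r) g))

⊗-zeroʳ : ∀ q → q ⊗ [] ≡ []
⊗-zeroʳ []      = refl
⊗-zeroʳ (t ∷ q) = ⊗-zeroʳ q

combination : List (Poly × Poly) → Poly
combination qs = sumP (map (λ { (q , g) → q ⊗ g }) qs)

combination-++ : ∀ qs rs → combination (qs ++ rs) ≡ combination qs ⊕ combination rs
combination-++ []             rs = refl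
combination-++ ((q , g) ∷ qs) rs =
  trans (cong (q ⊗ g ⊕_) (combination-++ qs rs)) (sym (List.++-assoc (q ⊗ g) (combination qs) (combination rs)))

scaleCofactors : Poly → List (Poly × Poly) → List (Poly × Poly)
scaleCofactors q = map (λ { (r , g) → q ⊗ r , g })

⊗-combination : ∀ q rs → q ⊗ combination rs ≈ combination (scaleCofactors q rs)
⊗-combination q []             = ≡⇒≈ (⊗-zeroʳ q)
⊗-combination q ((r , g) ∷ rs) = begin
  q ⊗ (r ⊗ g ⊕ combination rs)                     ≈⟨ ⊗-distribˡ-⊕ q (r ⊗ g) (combination rs) ⟩
  q ⊗ (r ⊗ g) ⊕ q ⊗ combination rs                 ≈⟨ ⊕-cong {q ⊗ (r ⊗ g)} {(q ⊗ r) ⊗ g}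
                                                              (≡⇒≈ (⊗-assoc q r g)) (⊗-combination q rs) ⟩
  (q ⊗ r) ⊗ g ⊕ combination (scaleCofactors q rs)  ∎
  where open SetoidReasoning ≈-setoid

module _ {H : List Poly} where

  InIdeal-resp-≈ : ∀ {f f′} → f ≈ f′ → InIdeal H f′ → InIdeal H f
  InIdeal-resp-≈ f≈f′ (qs , qs∈H , f′≈) = qs , qs∈H , λ i j → trans (f≈f′ i j) (f′≈ i j)

  InIdeal-[] : InIdeal H []
  InIdeal-[] = [] , [] , λ _ _ → refl

  InIdeal-⊕ : ∀ {f f′} → InIdeal H f → InIdeal H f′ → InIdeal H (f ⊕ f′)
  InIdeal-⊕ {f} {f′} (qs , qs∈H , f≈) (rs , rs∈H , f′≈) = qs ++ rs , All.++⁺ qs∈H rs∈H , f⊕f′≈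
    where
    open SetoidReasoning ≈-setoid
    f⊕f′≈ : f ⊕ f′ ≈ combination (qs ++ rs)
    f⊕f′≈ = begin
      f ⊕ f′                           ≈⟨ ⊕-cong {f} {combination qs} {f′} f≈ f′≈ ⟩
      combination qs ⊕ combination rs  ≡⟨ combination-++ qs rs ⟨
      combination (qs ++ rs)           ∎

  InIdeal-⊗ : ∀ q {g} → InIdeal H g → InIdeal H (q ⊗ g)
  InIdeal-⊗ q {g} (rs , rs∈H , g≈) = scaleCofactors q rs , All.map⁺ (All.map (λ g∈H → g∈H) rs∈H) , q⊗g≈
    where
    open SetoidReasoning ≈-setoid
    q⊗g≈ : q ⊗ g ≈ combination (scaleCofactors q rs)
    q⊗g≈ = begin
      q ⊗ g                              ≈⟨ ⊗-congʳ q g≈ ⟩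
      q ⊗ combination rs                 ≈⟨ ⊗-combination q rs ⟩
      combination (scaleCofactors q rs)  ∎

InIdeal-⊆ : ∀ {A B} → (∀ {g} → g ∈ A → InIdeal B g) → ∀ {f} → InIdeal A f → InIdeal B f
InIdeal-⊆ {A} {B} A⊆I[B] {f} (qs , qs∈A , f≈) =
  InIdeal-resp-≈ {f = f} {combination qs} f≈ (combination∈I[B] qs qs∈A)
  where
  combination∈I[B] : ∀ qs → All (λ { (_ , g) → g ∈ A }) qs → InIdeal B (combination qs)
  combination∈I[B] []             []            = InIdeal-[]
  combination∈I[B] ((q , g) ∷ qs) (g∈A ∷ qs∈A) =
    InIdeal-⊕ {f = q ⊗ g} (InIdeal-⊗ q (A⊆I[B] g∈A)) (combination∈I[B] qs qs∈A)

-- Deciding equality of polynomials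

InBox : ℕ → Term → Set
InBox N (_ , a , b) = a <ℕ N × b <ℕ N

boxSize : Poly → ℕ
boxSize = foldr (λ { (_ , a , b) N → suc a ⊔ suc b ⊔ N }) 0

InBox-boxSize : ∀ p {N} → boxSize p ≤ℕ N → All (InBox N) p
InBox-boxSize []                _      = []
InBox-boxSize ((_ , a , b) ∷ p) size≤N =
  (ℕ.m⊔n≤o⇒m≤o (suc a) (suc b) term≤N , ℕ.m⊔n≤o⇒n≤o (suc a) (suc b) term≤N) ∷
  InBox-boxSize p (ℕ.m⊔n≤o⇒n≤o (suc a ⊔ suc b) (boxSize p) size≤N)
  where term≤N = ℕ.m⊔n≤o⇒m≤o (suc a ⊔ suc b) (boxSize p) size≤N

coeff-outsideBox : ∀ {N} p i j → All (InBox N) p → ¬ (i <ℕ N × j <ℕ N) → coeff p i j ≡ + 0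
coeff-outsideBox {N} p i j p∈box ij∉box = coeff-∉ p i j (All.map (λ {t} → ≢ij t) p∈box)
  where
  ≢ij : ∀ t → InBox N t → monomial t ≢ (i , j)
  ≢ij _ t∈box refl = ij∉box t∈box

≈-byBox : ∀ {N} p q → All (InBox N) p → All (InBox N) q →
          (∀ {i} → i <ℕ N → ∀ {j} → j <ℕ N → coeff p i j ≡ coeff q i j) → p ≈ q
≈-byBox {N} p q p∈box q∈box agree i j with i ℕ.<? N ×-dec j ℕ.<? N
... | yes (i<N , j<N) = agree i<N j<N
... | no ij∉box       = trans (coeff-outsideBox p i j p∈box ij∉box) (sym (coeff-outsideBox q i j q∈box ij∉box))

_≈?_ : ∀ p q → Dec (p ≈ q)
p ≈? q = map′ (≈-byBox p q (InBox-boxSize p (ℕ.m≤m⊔n _ _)) (InBox-boxSize q (ℕ.m≤n⊔m _ _)))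
              (λ p≈q _ _ → p≈q _ _)
              (ℕ.allUpTo? (λ i → ℕ.allUpTo? (λ j → coeff p i j ℤ.≟ coeff q i j) N) N)
  where N = boxSize p ⊔ boxSize q

_≟ₚ_ : ∀ (p q : Poly) → Dec (p ≡ q)
_≟ₚ_ = List.≡-dec (≡-dec ℤ._≟_ _≟ₘ_)

open DecMembership _≟ₚ_ using (_∈?_)

InIdeal-byCofactors : ∀ H f qs → {True (all? (λ { (_ , g) → g ∈? H }) qs)} → {True (f ≈? combination qs)} →
                      InIdeal H f
InIdeal-byCofactors H f qs {qs∈H} {f≈} = qs , toWitness qs∈H , toWitness f≈

-- Head terms and D-reduction

_≤dl_ : ℕ × ℕ → ℕ × ℕ → Set
m ≤dl n = m <dl n ⊎ m ≡ n

<dl-trans : ∀ {m n o} → m <dl n → n <dl o → m <dl o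
<dl-trans (inj₁ m<n)         (inj₁ n<o)         = inj₁ (ℕ.<-trans m<n n<o)
<dl-trans (inj₁ m<n)         (inj₂ (n≡o , _))   = inj₁ (ℕ.<-≤-trans m<n (ℕ.≤-reflexive n≡o))
<dl-trans (inj₂ (m≡n , _))   (inj₁ n<o)         = inj₁ (ℕ.≤-<-trans (ℕ.≤-reflexive m≡n) n<o)
<dl-trans (inj₂ (m≡n , m<n)) (inj₂ (n≡o , n<o)) = inj₂ (trans m≡n n≡o , ℕ.<-trans m<n n<o)

≤dl-<dl-trans : ∀ {m n o} → m ≤dl n → n <dl o → m <dl o
≤dl-<dl-trans (inj₁ m<n)  n<o = <dl-trans m<n n<o
≤dl-<dl-trans (inj₂ refl) n<o = n<o

<dl-irrefl : ∀ {m} → ¬ m <dl m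
<dl-irrefl (inj₁ m<m)       = ℕ.<-irrefl refl m<m
<dl-irrefl (inj₂ (_ , m<m)) = ℕ.<-irrefl refl m<m

_≤dl?_ : ∀ m n → Dec (m ≤dl n)
(i , j) ≤dl? (i′ , j′) =
  ((i +ℕ j ℕ.<? i′ +ℕ j′) ⊎-dec ((i +ℕ j ℕ.≟ i′ +ℕ j′) ×-dec (i ℕ.<? i′)))
  ⊎-dec ((i , j) ≟ₘ (i′ , j′))

IsHead-intro : ∀ p {i₀ j₀ lc} → coeff p i₀ j₀ ≡ lc → lc ≢ + 0 →
               All (λ t → monomial t ≤dl (i₀ , j₀)) p → IsHead p i₀ j₀ lc
IsHead-intro p {i₀} {j₀} coeff≡lc lc≢0 p≤head = coeff≡lc , lc≢0 , λ i j head<ij →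
  coeff-∉ p i j (All.map (λ {t} t≤head → ≢above head<ij t t≤head) p≤head)
  where
  ≢above : ∀ {i j} → (i₀ , j₀) <dl (i , j) → ∀ t → monomial t ≤dl (i₀ , j₀) → monomial t ≢ (i , j)
  ≢above head<ij t t≤head refl = <dl-irrefl (≤dl-<dl-trans t≤head head<ij)

irreducible⇒coeff≡0 : ∀ {G p g i₀ j₀} → p ∈ G → IsHead p i₀ j₀ (+ 1) → (∀ h → ¬ DReducesG G g h) →
                      ∀ {i j} → i₀ ≤ℕ i → j₀ ≤ℕ j → coeff g i j ≡ + 0
irreducible⇒coeff≡0 {p = p} {g} {i₀} {j₀} p∈G head irreducible {i} {j} i₀≤i j₀≤j =
  decidable-stable (coeff g i j ℤ.≟ + 0) (λ coeff≢0 → irreducible reduct (p , p∈G , reduction coeff≢0))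
  where
  reduct = g ⊝ ((coeff g i j , i ∸ i₀ , j ∸ j₀) ∷ []) ⊗ p
  reduction : coeff g i j ≢ + 0 → DReduces p g reduct
  reduction coeff≢0 =
    i , j , i ∸ i₀ , j ∸ j₀ , coeff g i j , i₀ , j₀ , + 1 , coeff≢0 , head ,
    sym (ℕ.m∸n+n≡m i₀≤i) , sym (ℕ.m∸n+n≡m j₀≤j) , sym (ℤ.*-identityʳ _) , λ _ _ → refl

-- Evaluation in ℤ⁵

record ℤ⁵ : Set where
  constructor ⟨_,_,_,_,_⟩
  field v₀ v₁ v₂ v₃ v₄ : ℤ

open ℤ⁵

infixl 6 _+ᵛ_ _-ᵛ_
infixr 7 _·ᵛ_

_+ᵛ_ : ℤ⁵ → ℤ⁵ → ℤ⁵
⟨ a , b , c , d , e ⟩ +ᵛ ⟨ a′ , b′ , c′ , d′ , e′ ⟩ =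
  ⟨ a +ℤ a′ , b +ℤ b′ , c +ℤ c′ , d +ℤ d′ , e +ℤ e′ ⟩

_·ᵛ_ : ℤ → ℤ⁵ → ℤ⁵
k ·ᵛ ⟨ a , b , c , d , e ⟩ = ⟨ k *ℤ a , k *ℤ b , k *ℤ c , k *ℤ d , k *ℤ e ⟩

_-ᵛ_ : ℤ⁵ → ℤ⁵ → ℤ⁵
u -ᵛ v = u +ᵛ -1ℤ ·ᵛ v

0ᵛ : ℤ⁵
0ᵛ = ⟨ + 0 , + 0 , + 0 , + 0 , + 0 ⟩

componentwise : ∀ {a b c d e a′ b′ c′ d′ e′} → a ≡ a′ → b ≡ b′ → c ≡ c′ → d ≡ d′ → e ≡ e′ →
                ⟨ a , b , c , d , e ⟩ ≡ ⟨ a′ , b′ , c′ , d′ , e′ ⟩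
componentwise refl refl refl refl refl = refl

+ᵛ-assoc : ∀ u v w → (u +ᵛ v) +ᵛ w ≡ u +ᵛ (v +ᵛ w)
+ᵛ-assoc ⟨ a , b , c , d , e ⟩ ⟨ a′ , b′ , c′ , d′ , e′ ⟩ ⟨ a″ , b″ , c″ , d″ , e″ ⟩ =
  componentwise (ℤ.+-assoc a a′ a″) (ℤ.+-assoc b b′ b″) (ℤ.+-assoc c c′ c″)
                (ℤ.+-assoc d d′ d″) (ℤ.+-assoc e e′ e″)

+ᵛ-comm : ∀ u v → u +ᵛ v ≡ v +ᵛ u
+ᵛ-comm ⟨ a , b , c , d , e ⟩ ⟨ a′ , b′ , c′ , d′ , e′ ⟩ =
  componentwise (ℤ.+-comm a a′) (ℤ.+-comm b b′) (ℤ.+-comm c c′) (ℤ.+-comm d d′) (ℤ.+-comm e e′)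

+ᵛ-identityˡ : ∀ v → 0ᵛ +ᵛ v ≡ v
+ᵛ-identityˡ ⟨ a , b , c , d , e ⟩ =
  componentwise (ℤ.+-identityˡ a) (ℤ.+-identityˡ b) (ℤ.+-identityˡ c) (ℤ.+-identityˡ d) (ℤ.+-identityˡ e)

+ᵛ-leftComm : ∀ u v w → u +ᵛ (v +ᵛ w) ≡ v +ᵛ (u +ᵛ w)
+ᵛ-leftComm u v w = begin
  u +ᵛ (v +ᵛ w)  ≡⟨ +ᵛ-assoc u v w ⟨
  u +ᵛ v +ᵛ w    ≡⟨ cong (_+ᵛ w) (+ᵛ-comm u v) ⟩
  v +ᵛ u +ᵛ w    ≡⟨ +ᵛ-assoc v u w ⟩
  v +ᵛ (u +ᵛ w)  ∎
  where open ≡-Reasoning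

·ᵛ-distribˡ : ∀ k u v → k ·ᵛ (u +ᵛ v) ≡ k ·ᵛ u +ᵛ k ·ᵛ v
·ᵛ-distribˡ k ⟨ a , b , c , d , e ⟩ ⟨ a′ , b′ , c′ , d′ , e′ ⟩ =
  componentwise (ℤ.*-distribˡ-+ k a a′) (ℤ.*-distribˡ-+ k b b′) (ℤ.*-distribˡ-+ k c c′)
                (ℤ.*-distribˡ-+ k d d′) (ℤ.*-distribˡ-+ k e e′)

·ᵛ-distribʳ : ∀ k l v → (k +ℤ l) ·ᵛ v ≡ k ·ᵛ v +ᵛ l ·ᵛ v
·ᵛ-distribʳ k l ⟨ a , b , c , d , e ⟩ =
  componentwise (ℤ.*-distribʳ-+ a k l) (ℤ.*-distribʳ-+ b k l) (ℤ.*-distribʳ-+ c k l)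
                (ℤ.*-distribʳ-+ d k l) (ℤ.*-distribʳ-+ e k l)

·ᵛ-assoc : ∀ k l v → (k *ℤ l) ·ᵛ v ≡ k ·ᵛ l ·ᵛ v
·ᵛ-assoc k l ⟨ a , b , c , d , e ⟩ =
  componentwise (ℤ.*-assoc k l a) (ℤ.*-assoc k l b) (ℤ.*-assoc k l c) (ℤ.*-assoc k l d) (ℤ.*-assoc k l e)

·ᵛ-zeroˡ : ∀ v → + 0 ·ᵛ v ≡ 0ᵛ
·ᵛ-zeroˡ ⟨ a , b , c , d , e ⟩ = refl

·ᵛ-zeroʳ : ∀ k → k ·ᵛ 0ᵛ ≡ 0ᵛ
·ᵛ-zeroʳ k = componentwise (ℤ.*-zeroʳ k) (ℤ.*-zeroʳ k) (ℤ.*-zeroʳ k) (ℤ.*-zeroʳ k) (ℤ.*-zeroʳ k)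

u-v≡0⇒u≡v : ∀ u v → u -ᵛ v ≡ 0ᵛ → u ≡ v
u-v≡0⇒u≡v ⟨ a , b , c , d , e ⟩ ⟨ a′ , b′ , c′ , d′ , e′ ⟩ u-v≡0 =
  componentwise (cancel (cong v₀ u-v≡0)) (cancel (cong v₁ u-v≡0)) (cancel (cong v₂ u-v≡0))
                (cancel (cong v₃ u-v≡0)) (cancel (cong v₄ u-v≡0))
  where
  cancel : ∀ {x y} → x +ℤ -1ℤ *ℤ y ≡ + 0 → x ≡ y
  cancel {x} {y} x-y≡0 = ℤ.i-j≡0⇒i≡j x y (trans (cong (x +ℤ_) (sym (ℤ.-1*i≡-i y))) x-y≡0)

record IsLinear (f : ℤ⁵ → ℤ⁵) : Set where
  field
    +ᵛ-homo : ∀ u v → f (u +ᵛ v) ≡ f u +ᵛ f v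
    ·ᵛ-homo : ∀ k v → f (k ·ᵛ v) ≡ k ·ᵛ f v

  0ᵛ-homo : f 0ᵛ ≡ 0ᵛ
  0ᵛ-homo = trans (·ᵛ-homo (+ 0) 0ᵛ) (·ᵛ-zeroˡ (f 0ᵛ))

open Endo ℤ⁵ using (_^_; ^-homo)

^-linear : ∀ {f : ℤ⁵ → ℤ⁵} n → IsLinear f → IsLinear (f ^ n)
^-linear     zero    _        = record { +ᵛ-homo = λ _ _ → refl ; ·ᵛ-homo = λ _ _ → refl }
^-linear {f} (suc n) f-linear = record
  { +ᵛ-homo = λ u v → trans (cong f (+ᵛ-homo u v)) (IsLinear.+ᵛ-homo f-linear _ _)
  ; ·ᵛ-homo = λ k v → trans (cong f (·ᵛ-homo k v)) (IsLinear.·ᵛ-homo f-linear k _)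
  }
  where open IsLinear (^-linear n f-linear)

^-commute : ∀ {f g : ℤ⁵ → ℤ⁵} → (∀ v → f (g v) ≡ g (f v)) → ∀ n v → (f ^ n) (g v) ≡ g ((f ^ n) v)
^-commute     fg≡gf zero    v = refl
^-commute {f} fg≡gf (suc n) v = trans (cong f (^-commute fg≡gf n v)) (fg≡gf _)

module Evaluation
  (X Y : ℤ⁵ → ℤ⁵) (X-linear : IsLinear X) (Y-linear : IsLinear Y)
  (XY≡YX : ∀ v → X (Y v) ≡ Y (X v)) (one : ℤ⁵)
  where

  act : ℕ → ℕ → ℤ⁵ → ℤ⁵
  act a b = (X ^ a) ∘ (Y ^ b)

  act-linear : ∀ a b → IsLinear (act a b)
  act-linear a b = record
    { +ᵛ-homo = λ u v → trans (cong (X ^ a) (+ᵛ-homo Yᵇ-linear u v)) (+ᵛ-homo Xᵃ-linear _ _)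
    ; ·ᵛ-homo = λ k v → trans (cong (X ^ a) (·ᵛ-homo Yᵇ-linear k v)) (·ᵛ-homo Xᵃ-linear k _)
    }
    where
    open IsLinear
    Xᵃ-linear = ^-linear a X-linear
    Yᵇ-linear = ^-linear b Y-linear

  act-+ : ∀ a b a′ b′ v → act (a +ℕ a′) (b +ℕ b′) v ≡ act a b (act a′ b′ v)
  act-+ a b a′ b′ v = begin
    (X ^ (a +ℕ a′)) ((Y ^ (b +ℕ b′)) v)        ≡⟨ cong₂ _$_ (^-homo X a a′) (cong-app (^-homo Y b b′) v) ⟩
    (X ^ a) ((X ^ a′) ((Y ^ b) ((Y ^ b′) v)))  ≡⟨ cong (X ^ a) (Xᵃ′Yᵇ≡YᵇXᵃ′ ((Y ^ b′) v)) ⟩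
    (X ^ a) ((Y ^ b) ((X ^ a′) ((Y ^ b′) v)))  ∎
    where
    open ≡-Reasoning
    Xᵃ′Yᵇ≡YᵇXᵃ′ : ∀ w → (X ^ a′) ((Y ^ b) w) ≡ (Y ^ b) ((X ^ a′) w)
    Xᵃ′Yᵇ≡YᵇXᵃ′ w = sym (^-commute {Y} {X ^ a′} (λ u → sym (^-commute {X} {Y} XY≡YX a′ u)) b w)

  basis : ℕ → ℕ → ℤ⁵
  basis a b = act a b one

  eval : Poly → ℤ⁵
  eval []                = 0ᵛ
  eval ((c , a , b) ∷ p) = c ·ᵛ basis a b +ᵛ eval p

  eval-⊕ : ∀ p q → eval (p ⊕ q) ≡ eval p +ᵛ eval q
  eval-⊕ []                q = sym (+ᵛ-identityˡ (eval q))
  eval-⊕ ((c , a , b) ∷ p) q =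
    trans (cong (c ·ᵛ basis a b +ᵛ_) (eval-⊕ p q)) (sym (+ᵛ-assoc (c ·ᵛ basis a b) (eval p) (eval q)))

  eval-⊖ : ∀ p → eval (⊖ p) ≡ -1ℤ ·ᵛ eval p
  eval-⊖ []                = sym (·ᵛ-zeroʳ -1ℤ)
  eval-⊖ ((c , a , b) ∷ p) = begin
    (- c) ·ᵛ basis a b +ᵛ eval (⊖ p)
      ≡⟨ cong₂ _+ᵛ_ (cong (_·ᵛ basis a b) (sym (ℤ.-1*i≡-i c))) (eval-⊖ p) ⟩
    (-1ℤ *ℤ c) ·ᵛ basis a b +ᵛ -1ℤ ·ᵛ eval p
      ≡⟨ cong (_+ᵛ -1ℤ ·ᵛ eval p) (·ᵛ-assoc -1ℤ c (basis a b)) ⟩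
    -1ℤ ·ᵛ c ·ᵛ basis a b +ᵛ -1ℤ ·ᵛ eval p
      ≡⟨ ·ᵛ-distribˡ -1ℤ (c ·ᵛ basis a b) (eval p) ⟨
    -1ℤ ·ᵛ (c ·ᵛ basis a b +ᵛ eval p)
      ∎
    where open ≡-Reasoning

  eval-⊝ : ∀ p q → eval (p ⊝ q) ≡ eval p -ᵛ eval q
  eval-⊝ p q = trans (eval-⊕ p (⊖ q)) (cong (eval p +ᵛ_) (eval-⊖ q))

  eval-*ₜ : ∀ c a b g → eval ((c , a , b) *ₜ g) ≡ c ·ᵛ act a b (eval g)
  eval-*ₜ c a b []                  = sym (trans (cong (c ·ᵛ_) (IsLinear.0ᵛ-homo (act-linear a b))) (·ᵛ-zeroʳ c))
  eval-*ₜ c a b ((d , a′ , b′) ∷ g) = begin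
    (c *ℤ d) ·ᵛ basis (a +ℕ a′) (b +ℕ b′) +ᵛ eval ((c , a , b) *ₜ g)
      ≡⟨ cong₂ _+ᵛ_ (trans (·ᵛ-assoc c d _) (cong (λ v → c ·ᵛ d ·ᵛ v) (act-+ a b a′ b′ one)))
                    (eval-*ₜ c a b g) ⟩
    c ·ᵛ d ·ᵛ act a b (basis a′ b′) +ᵛ c ·ᵛ act a b (eval g)
      ≡⟨ cong (λ v → c ·ᵛ v +ᵛ c ·ᵛ act a b (eval g)) (·ᵛ-homo d (basis a′ b′)) ⟨
    c ·ᵛ act a b (d ·ᵛ basis a′ b′) +ᵛ c ·ᵛ act a b (eval g)
      ≡⟨ ·ᵛ-distribˡ c _ _ ⟨
    c ·ᵛ (act a b (d ·ᵛ basis a′ b′) +ᵛ act a b (eval g))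
      ≡⟨ cong (c ·ᵛ_) (+ᵛ-homo (d ·ᵛ basis a′ b′) (eval g)) ⟨
    c ·ᵛ act a b (d ·ᵛ basis a′ b′ +ᵛ eval g)
      ∎
    where
    open ≡-Reasoning
    open IsLinear (act-linear a b)

  eval-⊗ : ∀ q {g} → eval g ≡ 0ᵛ → eval (q ⊗ g) ≡ 0ᵛ
  eval-⊗ []                    g↦0 = refl
  eval-⊗ ((c , a , b) ∷ q) {g} g↦0 = begin
    eval ((c , a , b) *ₜ g ⊕ q ⊗ g)          ≡⟨ eval-⊕ ((c , a , b) *ₜ g) (q ⊗ g) ⟩
    eval ((c , a , b) *ₜ g) +ᵛ eval (q ⊗ g)  ≡⟨ cong₂ _+ᵛ_ (eval-*ₜ c a b g) (eval-⊗ q g↦0) ⟩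
    c ·ᵛ act a b (eval g) +ᵛ 0ᵛ              ≡⟨ cong (λ v → c ·ᵛ act a b v +ᵛ 0ᵛ) g↦0 ⟩
    c ·ᵛ act a b 0ᵛ +ᵛ 0ᵛ                    ≡⟨ cong (λ v → c ·ᵛ v +ᵛ 0ᵛ) (IsLinear.0ᵛ-homo (act-linear a b)) ⟩
    c ·ᵛ 0ᵛ +ᵛ 0ᵛ                            ≡⟨ cong (_+ᵛ 0ᵛ) (·ᵛ-zeroʳ c) ⟩
    0ᵛ                                       ∎
    where open ≡-Reasoning

  eval-deleteMonomial : ∀ a b p → eval p ≡ coeff p a b ·ᵛ basis a b +ᵛ eval (deleteMonomial (a , b) p)
  eval-deleteMonomial a b []                    = sym (+ᵛ-identityˡ 0ᵛ)
  eval-deleteMonomial a b (t@(c , a′ , b′) ∷ p) = byCase ((a′ , b′) ≟ₘ (a , b))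
    where
    open ≡-Reasoning
    rest = eval (deleteMonomial (a , b) p)
    byCase : Dec ((a′ , b′) ≡ (a , b)) →
             eval (t ∷ p) ≡ coeff (t ∷ p) a b ·ᵛ basis a b +ᵛ eval (deleteMonomial (a , b) (t ∷ p))
    byCase (yes refl) = begin
      c ·ᵛ basis a b +ᵛ eval p
        ≡⟨ cong (c ·ᵛ basis a b +ᵛ_) (eval-deleteMonomial a b p) ⟩
      c ·ᵛ basis a b +ᵛ (coeff p a b ·ᵛ basis a b +ᵛ rest)
        ≡⟨ +ᵛ-assoc (c ·ᵛ basis a b) (coeff p a b ·ᵛ basis a b) rest ⟨
      c ·ᵛ basis a b +ᵛ coeff p a b ·ᵛ basis a b +ᵛ rest
        ≡⟨ cong₂ _+ᵛ_ (·ᵛ-distribʳ c (coeff p a b) (basis a b))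
                      (cong eval (List.filter-reject (monomial≢? (a , b)) (_$ refl))) ⟨
      (c +ℤ coeff p a b) ·ᵛ basis a b +ᵛ eval (deleteMonomial (a , b) (t ∷ p))
        ≡⟨ cong (λ k → k ·ᵛ basis a b +ᵛ eval (deleteMonomial (a , b) (t ∷ p))) (coeff-∷-≡ t p refl) ⟨
      coeff (t ∷ p) a b ·ᵛ basis a b +ᵛ eval (deleteMonomial (a , b) (t ∷ p))
        ∎
    byCase (no t≢ab) = begin
      c ·ᵛ basis a′ b′ +ᵛ eval p
        ≡⟨ cong (c ·ᵛ basis a′ b′ +ᵛ_) (eval-deleteMonomial a b p) ⟩
      c ·ᵛ basis a′ b′ +ᵛ (coeff p a b ·ᵛ basis a b +ᵛ rest)
        ≡⟨ +ᵛ-leftComm (c ·ᵛ basis a′ b′) (coeff p a b ·ᵛ basis a b) rest ⟩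
      coeff p a b ·ᵛ basis a b +ᵛ eval (t ∷ deleteMonomial (a , b) p)
        ≡⟨ cong₂ (λ k r → k ·ᵛ basis a b +ᵛ eval r) (coeff-∷-≢ t p t≢ab)
                 (List.filter-accept (monomial≢? (a , b)) t≢ab) ⟨
      coeff (t ∷ p) a b ·ᵛ basis a b +ᵛ eval (deleteMonomial (a , b) (t ∷ p))
        ∎

  eval-IsZero : ∀ p → IsZero p → eval p ≡ 0ᵛ
  eval-IsZero p = bounded (length p) p ℕ.≤-refl
    where
    bounded : ∀ n p → length p ≤ℕ n → IsZero p → eval p ≡ 0ᵛ
    bounded _       []                      _           _   = refl
    bounded (suc n) p@(t@(_ , a , b) ∷ q) (s≤s |q|≤n) p≈0 = begin
      eval p                               ≡⟨ eval-deleteMonomial a b p ⟩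
      coeff p a b ·ᵛ basis a b +ᵛ eval p′  ≡⟨ cong₂ _+ᵛ_ (cong (_·ᵛ basis a b) (p≈0 a b)) (bounded n p′ |p′|≤n p′≈0) ⟩
      + 0 ·ᵛ basis a b +ᵛ 0ᵛ               ≡⟨ cong (_+ᵛ 0ᵛ) (·ᵛ-zeroˡ (basis a b)) ⟩
      0ᵛ                                   ∎
      where
      open ≡-Reasoning
      p′     = deleteMonomial (a , b) p
      |p′|≤n = ℕ.≤-trans (length-deleteMonomial-head t q) |q|≤n
      p′≈0   = IsZero-deleteMonomial (a , b) p p≈0

  eval-resp-≈ : ∀ p q → p ≈ q → eval p ≡ eval q
  eval-resp-≈ p q p≈q =
    u-v≡0⇒u≡v (eval p) (eval q) (trans (sym (eval-⊝ p q)) (eval-IsZero (p ⊝ q) (≈⇒IsZero-⊝ {p} {q} p≈q)))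

  module _ {G : List Poly} (G↦0 : ∀ {g} → g ∈ G → eval g ≡ 0ᵛ) where

    eval-InIdeal : ∀ {f} → InIdeal G f → eval f ≡ 0ᵛ
    eval-InIdeal {f} (qs , qs∈G , f≈) = trans (eval-resp-≈ f _ f≈) (eval-combination qs qs∈G)
      where
      eval-combination : ∀ qs → All (λ { (_ , g) → g ∈ G }) qs → eval (combination qs) ≡ 0ᵛ
      eval-combination []             []           = refl
      eval-combination ((q , g) ∷ qs) (g∈G ∷ qs∈G) =
        trans (eval-⊕ (q ⊗ g) (combination qs)) (cong₂ _+ᵛ_ (eval-⊗ q (G↦0 g∈G)) (eval-combination qs qs∈G))

    eval-DReduces : ∀ {f h} → DReducesG G f h → eval f ≡ 0ᵛ → eval h ≡ 0ᵛ
    eval-DReduces {f} {h} (p , p∈G , _ , _ , a , b , d , _ , _ , _ , _ , _ , _ , _ , _ , h≈) f↦0 = begin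
      eval h                                   ≡⟨ eval-resp-≈ h _ h≈ ⟩
      eval (f ⊝ ((d , a , b) ∷ []) ⊗ p)        ≡⟨ eval-⊝ f (((d , a , b) ∷ []) ⊗ p) ⟩
      eval f -ᵛ eval (((d , a , b) ∷ []) ⊗ p)  ≡⟨ cong₂ _-ᵛ_ f↦0 (eval-⊗ ((d , a , b) ∷ []) (G↦0 p∈G)) ⟩
      0ᵛ                                       ∎
      where open ≡-Reasoning

    eval-DReduces* : ∀ {f h} → Star (DReducesG G) f h → eval f ≡ 0ᵛ → eval h ≡ 0ᵛ
    eval-DReduces* ε        f↦0 = f↦0
    eval-DReduces* (r ◅ rs) f↦0 = eval-DReduces* rs (eval-DReduces r f↦0)

-- The basis C₁, C₂, C₃

-- Multiplication by x and by y in the basis 1, x, x², y, y², using x³ = −(x² + x + y² + y + 1),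
-- y³ = −(y² + y + x² + x + 1) and xy = 1.
mulX mulY : ℤ⁵ → ℤ⁵
mulX ⟨ a , b , c , d , e ⟩ = ⟨ d - c , a - c , b - c , e - c , - c ⟩
mulY ⟨ a , b , c , d , e ⟩ = ⟨ b - e , c - e , - e , a - e , d - e ⟩

private
  sub-distrib-+ : ∀ a b c d → (a +ℤ b) - (c +ℤ d) ≡ (a - c) +ℤ (b - d)
  sub-distrib-+ = solve-∀

  *-sub-factor : ∀ k a c → k *ℤ a - k *ℤ c ≡ k *ℤ (a - c)
  *-sub-factor = solve-∀

  sub-neg-cancel : ∀ a e → (a - e) - (- e) ≡ a
  sub-neg-cancel = solve-∀

mulX-linear : IsLinear mulX
mulX-linear = record
  { +ᵛ-homo = λ { ⟨ a , b , c , d , e ⟩ ⟨ a′ , b′ , c′ , d′ , e′ ⟩ →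
      componentwise (sub-distrib-+ d d′ c c′) (sub-distrib-+ a a′ c c′) (sub-distrib-+ b b′ c c′)
                    (sub-distrib-+ e e′ c c′) (ℤ.neg-distrib-+ c c′) }
  ; ·ᵛ-homo = λ { k ⟨ a , b , c , d , e ⟩ →
      componentwise (*-sub-factor k d c) (*-sub-factor k a c) (*-sub-factor k b c)
                    (*-sub-factor k e c) (ℤ.neg-distribʳ-* k c) }
  }

mulY-linear : IsLinear mulY
mulY-linear = record
  { +ᵛ-homo = λ { ⟨ a , b , c , d , e ⟩ ⟨ a′ , b′ , c′ , d′ , e′ ⟩ →
      componentwise (sub-distrib-+ b b′ e e′) (sub-distrib-+ c c′ e e′) (ℤ.neg-distrib-+ e e′)
                    (sub-distrib-+ a a′ e e′) (sub-distrib-+ d d′ e e′) }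
  ; ·ᵛ-homo = λ { k ⟨ a , b , c , d , e ⟩ →
      componentwise (*-sub-factor k b e) (*-sub-factor k c e) (ℤ.neg-distribʳ-* k e)
                    (*-sub-factor k a e) (*-sub-factor k d e) }
  }

mulX∘mulY≗id : ∀ v → mulX (mulY v) ≡ v
mulX∘mulY≗id ⟨ a , b , c , d , e ⟩ =
  componentwise (sub-neg-cancel a e) (sub-neg-cancel b e) (sub-neg-cancel c e) (sub-neg-cancel d e) (ℤ.neg-involutive e)

mulY∘mulX≗id : ∀ v → mulY (mulX v) ≡ v
mulY∘mulX≗id ⟨ a , b , c , d , e ⟩ =
  componentwise (sub-neg-cancel a c) (sub-neg-cancel b c) (ℤ.neg-involutive c) (sub-neg-cancel d c) (sub-neg-cancel e c)

open Evaluation mulX mulY mulX-linear mulY-linear (λ v → trans (mulX∘mulY≗id v) (sym (mulY∘mulX≗id v)))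
                ⟨ + 1 , + 0 , + 0 , + 0 , + 0 ⟩

Cs Hs : List Poly
Cs = C₁ ∷ C₂ ∷ C₃ ∷ []
Hs = H₁ ∷ H₂ ∷ H₃ ∷ H₄ ∷ []

eval-Cs : ∀ {g} → g ∈ Cs → eval g ≡ 0ᵛ
eval-Cs (here refl)                 = refl
eval-Cs (there (here refl))         = refl
eval-Cs (there (there (here refl))) = refl

standard : ℤ⁵ → Poly
standard ⟨ a , b , c , d , e ⟩ = (a , 0 , 0) ∷ (b , 1 , 0) ∷ (c , 2 , 0) ∷ (d , 0 , 1) ∷ (e , 0 , 2) ∷ []

coordinates : Poly → ℤ⁵
coordinates g = ⟨ coeff g 0 0 , coeff g 1 0 , coeff g 2 0 , coeff g 0 1 , coeff g 0 2 ⟩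

eval-standard : ∀ v → eval (standard v) ≡ v
eval-standard ⟨ a , b , c , d , e ⟩ =
  componentwise (at₀ a b c d e) (at₁ a b c d e) (at₂ a b c d e) (at₃ a b c d e) (at₄ a b c d e)
  where
  at₀ : ∀ a b c d e → a *ℤ + 1 +ℤ (b *ℤ + 0 +ℤ (c *ℤ + 0 +ℤ (d *ℤ + 0 +ℤ (e *ℤ + 0 +ℤ + 0)))) ≡ a
  at₀ = solve-∀
  at₁ : ∀ a b c d e → a *ℤ + 0 +ℤ (b *ℤ + 1 +ℤ (c *ℤ + 0 +ℤ (d *ℤ + 0 +ℤ (e *ℤ + 0 +ℤ + 0)))) ≡ b
  at₁ = solve-∀
  at₂ : ∀ a b c d e → a *ℤ + 0 +ℤ (b *ℤ + 0 +ℤ (c *ℤ + 1 +ℤ (d *ℤ + 0 +ℤ (e *ℤ + 0 +ℤ + 0)))) ≡ c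
  at₂ = solve-∀
  at₃ : ∀ a b c d e → a *ℤ + 0 +ℤ (b *ℤ + 0 +ℤ (c *ℤ + 0 +ℤ (d *ℤ + 1 +ℤ (e *ℤ + 0 +ℤ + 0)))) ≡ d
  at₃ = solve-∀
  at₄ : ∀ a b c d e → a *ℤ + 0 +ℤ (b *ℤ + 0 +ℤ (c *ℤ + 0 +ℤ (d *ℤ + 0 +ℤ (e *ℤ + 1 +ℤ + 0)))) ≡ e
  at₄ = solve-∀

IsZero-standard-0ᵛ : IsZero (standard 0ᵛ)
IsZero-standard-0ᵛ = IsZero-zeroCoefficients (standard 0ᵛ) (refl ∷ refl ∷ refl ∷ refl ∷ refl ∷ [])

head-C₁ : IsHead C₁ 3 0 (+ 1)
head-C₁ = IsHead-intro C₁ refl (λ ()) (from-yes (all? (λ t → monomial t ≤dl? (3 , 0)) C₁))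

head-C₂ : IsHead C₂ 0 3 (+ 1)
head-C₂ = IsHead-intro C₂ refl (λ ()) (from-yes (all? (λ t → monomial t ≤dl? (0 , 3)) C₂))

head-C₃ : IsHead C₃ 1 1 (+ 1)
head-C₃ = IsHead-intro C₃ refl (λ ()) (from-yes (all? (λ t → monomial t ≤dl? (1 , 1)) C₃))

irreducible⇒≈standard : ∀ {g} → (∀ h → ¬ DReducesG Cs g h) → g ≈ standard (coordinates g)
irreducible⇒≈standard {g} irreducible = ≈standard
  where
  x³∤ : ∀ k j → coeff g (3 +ℕ k) j ≡ + 0
  x³∤ k j = irreducible⇒coeff≡0 {g = g} (here refl) head-C₁ irreducible (ℕ.m≤m+n 3 k) z≤n
  y³∤ : ∀ i k → coeff g i (3 +ℕ k) ≡ + 0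
  y³∤ i k = irreducible⇒coeff≡0 {g = g} (there (here refl)) head-C₂ irreducible z≤n (ℕ.m≤m+n 3 k)
  xy∤ : ∀ i j → coeff g (suc i) (suc j) ≡ + 0
  xy∤ i j = irreducible⇒coeff≡0 {g = g} (there (there (here refl))) head-C₃ irreducible (s≤s z≤n) (s≤s z≤n)

  ≈standard : g ≈ standard (coordinates g)
  ≈standard 0                   0                   = sym (ℤ.+-identityʳ _)
  ≈standard 0                   1                   = sym (ℤ.+-identityʳ _)
  ≈standard 0                   2                   = sym (ℤ.+-identityʳ _)
  ≈standard 1                   0                   = sym (ℤ.+-identityʳ _)
  ≈standard 2                   0                   = sym (ℤ.+-identityʳ _)
  ≈standard 0                   (suc (suc (suc k))) = y³∤ 0 k
  ≈standard (suc (suc (suc k))) j                   = x³∤ k j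
  ≈standard 1                   (suc j)             = xy∤ 0 j
  ≈standard 2                   (suc j)             = xy∤ 1 j

Cs-isDGroebnerBasis : IsDGroebnerBasis Cs
Cs-isDGroebnerBasis f g f∈I (f↠g , g-irreducible) i j = begin
  coeff g i j                           ≡⟨ g≈standard i j ⟩
  coeff (standard (coordinates g)) i j  ≡⟨ cong (λ v → coeff (standard v) i j) coordinates≡0 ⟩
  coeff (standard 0ᵛ) i j               ≡⟨ IsZero-standard-0ᵛ i j ⟩
  + 0                                   ∎
  where
  open ≡-Reasoning
  g≈standard = irreducible⇒≈standard {g} g-irreducible
  coordinates≡0 : coordinates g ≡ 0ᵛ
  coordinates≡0 = begin
    coordinates g                    ≡⟨ eval-standard (coordinates g) ⟨
    eval (standard (coordinates g))  ≡⟨ eval-resp-≈ g (standard (coordinates g)) g≈standard ⟨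
    eval g                           ≡⟨ eval-DReduces* eval-Cs f↠g (eval-InIdeal eval-Cs f∈I) ⟩
    0ᵛ                               ∎

𝟙 𝕩 𝕪 : Poly
𝟙 = (+ 1 , 0 , 0) ∷ []
𝕩 = (+ 1 , 1 , 0) ∷ []
𝕪 = (+ 1 , 0 , 1) ∷ []

Cs⊆I[Hs] : ∀ {g} → g ∈ Cs → InIdeal Hs g
Cs⊆I[Hs] (here refl)                 = InIdeal-byCofactors Hs C₁ ((𝟙 ⊕ 𝕪 , H₃) ∷ (⊖ 𝟙 , H₄) ∷ [])
Cs⊆I[Hs] (there (here refl))         = InIdeal-byCofactors Hs C₂ ((𝟙 ⊕ 𝕩 , H₁) ∷ (⊖ 𝟙 , H₂) ∷ [])
Cs⊆I[Hs] (there (there (here refl))) = InIdeal-byCofactors Hs C₃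
  ((⊖ (𝟙 ⊕ 𝕩 ⊗ 𝕪 ⊕ 𝕩 ⊗ 𝕩 ⊗ 𝕪) , H₁) ∷ (𝟙 ⊕ 𝕩 ⊗ 𝕪 , H₂) ∷ (𝕪 ⊕ 𝕪 ⊗ 𝕪 , H₃) ∷ (⊖ 𝕪 , H₄) ∷ [])

Hs⊆I[Cs] : ∀ {h} → h ∈ Hs → InIdeal Cs h
Hs⊆I[Cs] (here refl)                         = InIdeal-byCofactors Cs H₁ ((𝕪 , C₂) ∷ (⊖ (𝕩 ⊕ 𝟙) , C₃) ∷ [])
Hs⊆I[Cs] (there (here refl))                 = InIdeal-byCofactors Cs H₂
  ((⊖ 𝕪 , C₁) ∷ (𝕩 ⊗ 𝕪 ⊕ 𝕪 , C₂) ∷ (⊖ 𝕩 , C₃) ∷ [])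
Hs⊆I[Cs] (there (there (here refl)))         = InIdeal-byCofactors Cs H₃ ((𝕩 , C₁) ∷ (⊖ (𝕪 ⊕ 𝟙) , C₃) ∷ [])
Hs⊆I[Cs] (there (there (there (here refl)))) = InIdeal-byCofactors Cs H₄
  ((𝕩 ⊗ 𝕪 ⊕ 𝕩 , C₁) ∷ (⊖ 𝕩 , C₂) ∷ (⊖ 𝕪 , C₃) ∷ [])

proposition5 : IsGroebnerBasisOf (C₁ ∷ C₂ ∷ C₃ ∷ []) (H₁ ∷ H₂ ∷ H₃ ∷ H₄ ∷ [])
proposition5 = Cs-isDGroebnerBasis , λ f → mk⇔ (InIdeal-⊆ Cs⊆I[Hs] {f}) (InIdeal-⊆ Hs⊆I[Cs] {f})
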